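{- Fix $\Join\,\in\{;,\parallel\}$. Let $\mathcal{X}$ and $\mathcal{Y}$ be elementary programs such that the empty partial string $\bot$ is not an element of $\mathcal{Y}$. Let $\ell_\mathcal{X} = \max\{|x| : x \in \mathcal{X}\}$ and $\ell_\mathcal{Y} = \min\{|y| : y \in \mathcal{Y}\}$, and let $n = \lfloor \ell_\mathcal{X}/\ell_\mathcal{Y} \rfloor$. Then $\mathcal{X}^{\Join} \subseteq \mathcal{Y}^{\Join}$ if and only if $\mathcal{X} \subseteq \bigcup_{k=0}^{n} \mathcal{Y}^{k\cdot\Join}$.
   Context: Fix a nonempty set $E$ of events and an alphabet $\Gamma$. A partial string is a triple $p = (E_p, \alpha_p, \preceq_p)$ with $E_p \subseteq E$, $\alpha_p \colon E_p \to \Gamma$ a labelling function and $\preceq_p$ a partial order on $E_p$. It is finite if $E_p$ is finite; $\mathsf{P}_f$ denotes the set of finite partial strings; the size $|p|$ is the cardinality of $E_p$; $\bot$ denotes the empty partial string ($E_\bot = \emptyset$). Partial strings $x,y$ are disjoint if $E_x\cap E_y=\emptyset$; partial strings are always assumed to be made disjoint by renaming events when composed. For disjoint $x,y$, the concurrent composition $x \parallel y$ and sequential composition $x ; y$ both have event set $E_x \cup E_y$ and labels inherited from $x$ and $y$; $e \preceq_{x\parallel y} e'$ iff $e \preceq_x e'$ or $e \preceq_y e'$; and $e \preceq_{x;y} e'$ iff ($e \in E_x$ and $e' \in E_y$) or $e \preceq_{x\parallel y} e'$. A monotonic bijective morphism $f\colon x \to y$ is a bijection $E_x \to E_y$ with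 $\alpha_x(e) = \alpha_y(f(e))$ for all $e$, and $e \preceq_x e' \Rightarrow f(e) \preceq_y f(e')$. Write $x \sqsubseteq y$ ($x$ refines $y$) if there is a monotonic bijective morphism from $y$ to $x$. For $\mathcal{X} \subseteq \mathsf{P}_f$ let ${\downarrow}\mathcal{X} = \{y \in \mathsf{P}_f : \exists x \in \mathcal{X},\ y \sqsubseteq x\}$. A program is a set $\mathcal{X} \subseteq \mathsf{P}_f$ with ${\downarrow}\mathcal{X} = \mathcal{X}$; the programs form a complete lattice under $\subseteq$. Put $1 = \{\bot\}$. For $\Join\,\in\{;,\parallel\}$ and programs $\mathcal{X},\mathcal{Y}$, $\mathcal{X} \Join \mathcal{Y} = {\downarrow}\{x \Join y : x \in \mathcal{X}, y \in \mathcal{Y}\}$. For a program $\mathcal{P}$, $\mathcal{P}^{\Join}$ is the least fixed point (w.r.t. $\subseteq$ on programs) of $\mathcal{Z} \mapsto 1 \cup (\mathcal{P} \Join \mathcal{Z})$; and $\mathcal{P}^{0\cdot\Join} = 1$, $\mathcal{P}^{(n+1)\cdot\Join} = \mathcal{P} \Join \mathcal{P}^{n\cdot\Join}$. A program $\mathcal{P}$ is elementary if $\mathcal{P} = {\downarrow}\mathcal{Q}$ for some finite nonempty set $\mathcal{Q}$ of finite partial strings. -}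

module Defs where

open import Level using (0ℓ; Lift) renaming (suc to lsuc)
open import Data.Nat using (ℕ; zero; suc; _≤_) renaming (_+_ to _ℕ+_)
open import Data.Fin using (Fin; splitAt; join)
open import Data.Fin.Properties using (join-splitAt)
open import Data.Sum using (_⊎_; inj₁; inj₂; [_,_]′)
open import Data.Product using (Σ; ∃; _×_; _,_)
open import Data.Unit using (⊤; tt)
open import Data.Empty using (⊥)
open import Data.List.NonEmpty using (List⁺; toList)
open import Data.List.Membership.Propositional using (_∈_)
open import Relation.Binary.Core using (Rel)
open import Relation.Binary.Structures using (IsPartialOrder; IsPreorder)
open import Relation.Binary.PropositionalEquality
  using (_≡_; refl; cong; isEquivalence; trans; sym)
open import Function.Definitions using (Bijective)
open import Function.Bundles using (_⇔_)

-- Since programs are closed under refinement (hence under isomorphism)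
-- and compositions rename events to be disjoint, a finite partial string
-- is represented with event set Fin size (canonical finite event names).

record PS (Γ : Set) : Set₁ where
  constructor mkPS
  field
    size : ℕ
    lab  : Fin size → Γ
    ord  : Rel (Fin size) 0ℓ
    isPO : IsPartialOrder _≡_ ord

open PS public

botPO : IsPartialOrder _≡_ (λ (_ _ : Fin 0) → ⊤)
botPO = record
  { isPreorder = record
    { isEquivalence = isEquivalence ; reflexive = λ _ → tt ; trans = λ _ _ → tt }
  ; antisym = λ { {()} } }

botPS : ∀ {Γ} → PS Γ
botPS = mkPS 0 (λ ()) (λ _ _ → ⊤) botPO

ParRel : ∀ {A B : Set} → Rel A 0ℓ → Rel B 0ℓ → Rel (A ⊎ B) 0ℓ
ParRel R S (inj₁ a) (inj₁ a') = R a a'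
ParRel R S (inj₂ b) (inj₂ b') = S b b'
ParRel R S _ _ = ⊥

SeqRel : ∀ {A B : Set} → Rel A 0ℓ → Rel B 0ℓ → Rel (A ⊎ B) 0ℓ
SeqRel R S (inj₁ a) (inj₁ a') = R a a'
SeqRel R S (inj₂ b) (inj₂ b') = S b b'
SeqRel R S (inj₁ a) (inj₂ b)  = ⊤
SeqRel R S (inj₂ b) (inj₁ a)  = ⊥

module _ {A B : Set} {R : Rel A 0ℓ} {S : Rel B 0ℓ}
         (pR : IsPartialOrder _≡_ R) (pS : IsPartialOrder _≡_ S) where
  private
    module R = IsPartialOrder pR
    module S = IsPartialOrder pS

  parPO : IsPartialOrder _≡_ (ParRel R S)
  parPO = record
    { isPreorder = record { isEquivalence = isEquivalence ; reflexive = rf ; trans = λ {u} {v} {w} → tr {u} {v} {w} }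
    ; antisym = an }
    where
    rf : ∀ {u v} → u ≡ v → ParRel R S u v
    rf {inj₁ a} refl = R.refl
    rf {inj₂ b} refl = S.refl
    tr : ∀ {u v w} → ParRel R S u v → ParRel R S v w → ParRel R S u w
    tr {inj₁ _} {inj₁ _} {inj₁ _} p q = R.trans p q
    tr {inj₂ _} {inj₂ _} {inj₂ _} p q = S.trans p q
    an : ∀ {u v} → ParRel R S u v → ParRel R S v u → u ≡ v
    an {inj₁ _} {inj₁ _} p q = cong inj₁ (R.antisym p q)
    an {inj₂ _} {inj₂ _} p q = cong inj₂ (S.antisym p q)

  seqPO : IsPartialOrder _≡_ (SeqRel R S)
  seqPO = record
    { isPreorder = record { isEquivalence = isEquivalence ; reflexive = rf ; trans = λ {u} {v} {w} → tr {u} {v} {w} }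
    ; antisym = an }
    where
    rf : ∀ {u v} → u ≡ v → SeqRel R S u v
    rf {inj₁ a} refl = R.refl
    rf {inj₂ b} refl = S.refl
    tr : ∀ {u v w} → SeqRel R S u v → SeqRel R S v w → SeqRel R S u w
    tr {inj₁ _} {inj₁ _} {inj₁ _} p q = R.trans p q
    tr {inj₁ _} {inj₁ _} {inj₂ _} p q = tt
    tr {inj₁ _} {inj₂ _} {inj₂ _} p q = tt
    tr {inj₂ _} {inj₂ _} {inj₂ _} p q = S.trans p q
    an : ∀ {u v} → SeqRel R S u v → SeqRel R S v u → u ≡ v
    an {inj₁ _} {inj₁ _} p q = cong inj₁ (R.antisym p q)
    an {inj₂ _} {inj₂ _} p q = cong inj₂ (S.antisym p q)

pullPO : ∀ m n {T : Rel (Fin m ⊎ Fin n) 0ℓ} → IsPartialOrder _≡_ T →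
         IsPartialOrder _≡_ (λ i j → T (splitAt m i) (splitAt m j))
pullPO m n pT = record
  { isPreorder = record
    { isEquivalence = isEquivalence
    ; reflexive = λ { refl → T.refl }
    ; trans = T.trans }
  ; antisym = λ {i} {j} p q →
      trans (sym (join-splitAt m n i))
        (trans (cong (join m n) (T.antisym p q)) (join-splitAt m n j)) }
  where module T = IsPartialOrder pT

data Op : Set where
  seq par : Op

_∥ₚ_ : ∀ {Γ} → PS Γ → PS Γ → PS Γ
x ∥ₚ y = mkPS (size x ℕ+ size y) (λ i → [ lab x , lab y ]′ (splitAt (size x) i))
  (λ i j → ParRel (ord x) (ord y) (splitAt (size x) i) (splitAt (size x) j))
  (pullPO (size x) (size y) (parPO (isPO x) (isPO y)))

_⨾ₚ_ : ∀ {Γ} → PS Γ → PS Γ → PS Γ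
x ⨾ₚ y = mkPS (size x ℕ+ size y) (λ i → [ lab x , lab y ]′ (splitAt (size x) i))
  (λ i j → SeqRel (ord x) (ord y) (splitAt (size x) i) (splitAt (size x) j))
  (pullPO (size x) (size y) (seqPO (isPO x) (isPO y)))

compose : ∀ {Γ} → Op → PS Γ → PS Γ → PS Γ
compose seq = _⨾ₚ_
compose par = _∥ₚ_

_⊑_ : ∀ {Γ} → PS Γ → PS Γ → Set
x ⊑ y = Σ (Fin (size y) → Fin (size x)) λ f →
          Bijective _≡_ _≡_ f
        × (∀ e → lab y e ≡ lab x (f e))
        × (∀ e e' → ord y e e' → ord x (f e) (f e'))

PSet : Set → Set₂
PSet Γ = PS Γ → Set₁

_⊆ₚ_ : ∀ {Γ} → PSet Γ → PSet Γ → Set₁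
X ⊆ₚ Y = ∀ z → X z → Y z

↓ : ∀ {Γ} → PSet Γ → PSet Γ
↓ X y = ∃ λ x → X x × (y ⊑ x)

-- 𝒳 is a program: ↓𝒳 = 𝒳 (the inclusion 𝒳 ⊆ ↓𝒳 always holds)
IsProgram : ∀ {Γ} → PSet Γ → Set₁
IsProgram X = ↓ X ⊆ₚ X

-- 1 = {⊥}  (as a program, i.e. closed under refinement)
One : ∀ {Γ} → PSet Γ
One z = Lift (lsuc 0ℓ) (z ⊑ botPS)

_∪ₚ_ : ∀ {Γ} → PSet Γ → PSet Γ → PSet Γ
(X ∪ₚ Y) z = X z ⊎ Y z

comp : ∀ {Γ} → Op → PSet Γ → PSet Γ → PSet Γ
comp op X Y z = ∃ λ x → ∃ λ y → X x × Y y × (z ⊑ compose op x y)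

-- 𝒫^⋈ : least fixed point of 𝒵 ↦ 1 ∪ (𝒫 ⋈ 𝒵), as an inductive predicate
data Star {Γ} (op : Op) (P : PSet Γ) : PSet Γ where
  stop : ∀ {z} → One z → Star op P z
  step : ∀ {z} x y → P x → Star op P y → z ⊑ compose op x y → Star op P z

Pow : ∀ {Γ} → Op → PSet Γ → ℕ → PSet Γ
Pow op P zero    = One
Pow op P (suc k) = comp op P (Pow op P k)

PowUpTo : ∀ {Γ} → Op → PSet Γ → ℕ → PSet Γ
PowUpTo op P n z = ∃ λ k → k ≤ n × Pow op P k z

Elementary : ∀ {Γ} → PSet Γ → Set₁
Elementary {Γ} P = ∃ λ (Q : List⁺ (PS Γ)) →
  ∀ z → P z ⇔ (∃ λ q → q ∈ toList Q × (z ⊑ q))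

IsMaxSize : ∀ {Γ} → PSet Γ → ℕ → Set₁
IsMaxSize X m = (∃ λ x → X x × size x ≡ m) × (∀ x → X x → size x ≤ m)

IsMinSize : ∀ {Γ} → PSet Γ → ℕ → Set₁
IsMinSize Y m = (∃ λ y → Y y × size y ≡ m) × (∀ y → Y y → m ≤ size y)

module Submission where

-- A finite partial string x lies in 𝒳^⋈ as soon as x ∈ 𝒳,
-- since x ⊑ x ⋈ ⊥.  Hence 𝒳^⋈ ⊆ 𝒴^⋈ forces every x ∈ 𝒳 into 𝒴^⋈, i.e.
-- into some power 𝒴^{k·⋈}; an element of 𝒴^{k·⋈} has at least k·ℓ𝒴
-- events, while |x| ≤ ℓ𝒳, so k ≤ ⌊ℓ𝒳/ℓ𝒴⌋.  Conversely, if every x ∈ 𝒳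
-- lies in some 𝒴^{k·⋈}, an element z ⊑ x ⋈ w of 𝒳^⋈ (with w ∈ 𝒳^⋈,
-- inductively in 𝒴^⋈) lies in 𝒴^{k·⋈} ⋈ 𝒴^⋈ ⊆ 𝒴^⋈.
--
-- From these, the closure facts about 𝒫^⋈ and
-- 𝒫^{k·⋈} and a size bound for 𝒫^{k·⋈} follow, and the theorem is a
-- direct combination.

open import Defs
open import Data.Nat using (ℕ; NonZero; _/_)
open import Relation.Nullary using (¬_)
open import Function.Bundles using (_⇔_; mk⇔)

open import Level using (0ℓ; lift)
open import Data.Nat using (zero; suc; _≤_; _+_; _*_; z≤n)
open import Data.Nat.Properties using (≤-trans; +-mono-≤; module ≤-Reasoning)
open import Data.Nat.DivMod using (/-monoˡ-≤; m*n/n≡m)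
open import Data.Fin using (Fin; splitAt; join)
open import Data.Fin.Properties using (splitAt-join; join-splitAt; injective⇒≤)
open import Data.Sum using (_⊎_; inj₁; inj₂; [_,_]′; map; assocˡ; assocʳ)
open import Data.Product using (∃; _,_; proj₁; proj₂)
open import Data.Unit using (tt)
open import Relation.Binary.Core using (Rel)
open import Relation.Binary.PropositionalEquality
  using (_≡_; refl; cong; trans; sym; subst; subst₂)
import Relation.Binary.Reasoning.Base.Single
open import Relation.Binary.Reasoning.Syntax using (module ⊑-syntax)

private
  variable
    Γ : Set

-- A set of events with labels and a binary relation; partial strings and
-- disjoint sums of partial strings are instances.
record LStr (Γ : Set) : Set₁ where
  constructor lstr
  field
    Ev  : Set
    lbl : Ev → Γ
    rel : Rel Ev 0ℓ
open LStr

record Mor (A B : LStr Γ) : Set where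
  field
    to       : Ev A → Ev B
    from     : Ev B → Ev A
    from∘to  : ∀ a → from (to a) ≡ a
    to∘from  : ∀ b → to (from b) ≡ b
    lbl-pres : ∀ a → lbl A a ≡ lbl B (to a)
    rel-pres : ∀ a a' → rel A a a' → rel B (to a) (to a')
open Mor

Mor-id : {A : LStr Γ} → Mor A A
Mor-id = record
  { to = λ a → a ; from = λ a → a ; from∘to = λ _ → refl ; to∘from = λ _ → refl
  ; lbl-pres = λ _ → refl ; rel-pres = λ _ _ r → r }

infixr 9 _∘ᴹ_
_∘ᴹ_ : {A B C : LStr Γ} → Mor B C → Mor A B → Mor A C
g ∘ᴹ f = record
  { to       = λ a → to g (to f a)
  ; from     = λ c → from f (from g c)
  ; from∘to  = λ a → trans (cong (from f) (from∘to g (to f a))) (from∘to f a)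
  ; to∘from  = λ c → trans (cong (to g) (to∘from f (from g c))) (to∘from g c)
  ; lbl-pres = λ a → trans (lbl-pres f a) (lbl-pres g (to f a))
  ; rel-pres = λ a a' r → rel-pres g _ _ (rel-pres f a a' r) }

Mor-inverse : {A B : LStr Γ} (f : Mor A B) →
              (∀ b b' → rel B b b' → rel A (from f b) (from f b')) → Mor B A
Mor-inverse {B = B} f from-mono = record
  { to = from f ; from = to f ; from∘to = to∘from f ; to∘from = from∘to f
  ; lbl-pres = λ b → trans (cong (lbl B) (sym (to∘from f b))) (sym (lbl-pres f (from f b)))
  ; rel-pres = from-mono }

⟦_⟧ : PS Γ → LStr Γ
⟦ x ⟧ = lstr (Fin (size x)) (lab x) (ord x)

Mor⇒⊑ : (x y : PS Γ) → Mor ⟦ y ⟧ ⟦ x ⟧ → x ⊑ y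
Mor⇒⊑ x y f =
  to f , (injective , λ b → from f b , λ { refl → to∘from f b }) , lbl-pres f , rel-pres f
  where
  injective : ∀ {a b} → to f a ≡ to f b → a ≡ b
  injective {a} {b} eq = trans (sym (from∘to f a)) (trans (cong (from f) eq) (from∘to f b))

⊑⇒Mor : (x y : PS Γ) → x ⊑ y → Mor ⟦ y ⟧ ⟦ x ⟧
⊑⇒Mor _ _ (f , (injective , surjective) , lbl-pres , rel-pres) = record
  { to = f ; from = λ b → proj₁ (surjective b)
  ; from∘to = λ a → injective (proj₂ (surjective (f a)) refl)
  ; to∘from = λ b → proj₂ (surjective b) refl
  ; lbl-pres = lbl-pres ; rel-pres = rel-pres }

⊑-refl : (x : PS Γ) → x ⊑ x
⊑-refl x = Mor⇒⊑ x x Mor-id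

⊑-trans : {x y z : PS Γ} → x ⊑ y → y ⊑ z → x ⊑ z
⊑-trans {x = x} {y} {z} p q = Mor⇒⊑ x z (⊑⇒Mor x y p ∘ᴹ ⊑⇒Mor y z q)

module ⊑-Reasoning {Γ : Set} where
  private
    module Base = Relation.Binary.Reasoning.Base.Single (_⊑_ {Γ})
      (λ {x} → ⊑-refl x) (λ {x} {y} {z} → ⊑-trans {x = x} {y} {z})
  open Base public using (begin_; _∎)
  open ⊑-syntax Base._IsRelatedTo_ Base._IsRelatedTo_ Base.∼-go public

⊑-size : {x y : PS Γ} → x ⊑ y → size y ≤ size x
⊑-size (_ , (injective , _) , _) = injective⇒≤ injective

OpRel : Op → {A B : Set} → Rel A 0ℓ → Rel B 0ℓ → Rel (A ⊎ B) 0ℓ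
OpRel seq = SeqRel
OpRel par = ParRel

Sum : Op → LStr Γ → LStr Γ → LStr Γ
Sum op A B = lstr (Ev A ⊎ Ev B) [ lbl A , lbl B ]′ (OpRel op (rel A) (rel B))

module _ {m n : ℕ} (l : Fin m ⊎ Fin n → Γ) (R : Rel (Fin m ⊎ Fin n) 0ℓ) where
  Pulled : LStr Γ
  Pulled = lstr (Fin (m + n)) (λ i → l (splitAt m i)) (λ i j → R (splitAt m i) (splitAt m j))

  split-Mor : Mor Pulled (lstr (Fin m ⊎ Fin n) l R)
  split-Mor = record
    { to = splitAt m ; from = join m n
    ; from∘to = join-splitAt m n ; to∘from = splitAt-join m n
    ; lbl-pres = λ _ → refl ; rel-pres = λ _ _ r → r }

  join-Mor : Mor (lstr (Fin m ⊎ Fin n) l R) Pulled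
  join-Mor = Mor-inverse split-Mor λ b b' r →
    subst₂ R (sym (splitAt-join m n b)) (sym (splitAt-join m n b')) r

split : (op : Op) (x y : PS Γ) → Mor ⟦ compose op x y ⟧ (Sum op ⟦ x ⟧ ⟦ y ⟧)
split seq x y = split-Mor [ lab x , lab y ]′ (SeqRel (ord x) (ord y))
split par x y = split-Mor [ lab x , lab y ]′ (ParRel (ord x) (ord y))

unsplit : (op : Op) (x y : PS Γ) → Mor (Sum op ⟦ x ⟧ ⟦ y ⟧) ⟦ compose op x y ⟧
unsplit seq x y = join-Mor [ lab x , lab y ]′ (SeqRel (ord x) (ord y))
unsplit par x y = join-Mor [ lab x , lab y ]′ (ParRel (ord x) (ord y))

size-compose : (op : Op) (x y : PS Γ) → size (compose op x y) ≡ size x + size y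
size-compose seq x y = refl
size-compose par x y = refl

map-mono : (op : Op) {A A' B B' : Set} {R : Rel A 0ℓ} {R' : Rel A' 0ℓ}
           {S : Rel B 0ℓ} {S' : Rel B' 0ℓ} {f : A → A'} {g : B → B'} →
           (∀ a a' → R a a' → R' (f a) (f a')) → (∀ b b' → S b b' → S' (g b) (g b')) →
           ∀ u v → OpRel op R S u v → OpRel op R' S' (map f g u) (map f g v)
map-mono seq f-mono g-mono (inj₁ a) (inj₁ a') r = f-mono a a' r
map-mono seq f-mono g-mono (inj₁ a) (inj₂ b') r = tt
map-mono seq f-mono g-mono (inj₂ b) (inj₂ b') r = g-mono b b' r
map-mono par f-mono g-mono (inj₁ a) (inj₁ a') r = f-mono a a' r
map-mono par f-mono g-mono (inj₂ b) (inj₂ b') r = g-mono b b' r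

Sum-map : (op : Op) {A A' B B' : LStr Γ} → Mor A A' → Mor B B' →
          Mor (Sum op A B) (Sum op A' B')
Sum-map op f g = record
  { to       = map (to f) (to g)
  ; from     = map (from f) (from g)
  ; from∘to  = λ { (inj₁ a) → cong inj₁ (from∘to f a) ; (inj₂ b) → cong inj₂ (from∘to g b) }
  ; to∘from  = λ { (inj₁ a) → cong inj₁ (to∘from f a) ; (inj₂ b) → cong inj₂ (to∘from g b) }
  ; lbl-pres = λ { (inj₁ a) → lbl-pres f a ; (inj₂ b) → lbl-pres g b }
  ; rel-pres = map-mono op (rel-pres f) (rel-pres g) }

assocˡ-mono : (op : Op) {A B C : Set} {R : Rel A 0ℓ} {S : Rel B 0ℓ} {T : Rel C 0ℓ}
              (u v : A ⊎ (B ⊎ C)) → OpRel op R (OpRel op S T) u v →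
              OpRel op (OpRel op R S) T (assocˡ u) (assocˡ v)
assocˡ-mono seq (inj₁ a)        (inj₁ a')        r = r
assocˡ-mono seq (inj₁ a)        (inj₂ (inj₁ b))  r = tt
assocˡ-mono seq (inj₁ a)        (inj₂ (inj₂ c))  r = tt
assocˡ-mono seq (inj₂ (inj₁ b)) (inj₂ (inj₁ b')) r = r
assocˡ-mono seq (inj₂ (inj₁ b)) (inj₂ (inj₂ c))  r = tt
assocˡ-mono seq (inj₂ (inj₂ c)) (inj₂ (inj₂ c')) r = r
assocˡ-mono par (inj₁ a)        (inj₁ a')        r = r
assocˡ-mono par (inj₂ (inj₁ b)) (inj₂ (inj₁ b')) r = r
assocˡ-mono par (inj₂ (inj₂ c)) (inj₂ (inj₂ c')) r = r

Sum-assoc : (op : Op) {A B C : LStr Γ} → Mor (Sum op A (Sum op B C)) (Sum op (Sum op A B) C)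
Sum-assoc op = record
  { to = assocˡ ; from = assocʳ
  ; from∘to  = λ { (inj₁ a) → refl ; (inj₂ (inj₁ b)) → refl ; (inj₂ (inj₂ c)) → refl }
  ; to∘from  = λ { (inj₁ (inj₁ a)) → refl ; (inj₁ (inj₂ b)) → refl ; (inj₂ c) → refl }
  ; lbl-pres = λ { (inj₁ a) → refl ; (inj₂ (inj₁ b)) → refl ; (inj₂ (inj₂ c)) → refl }
  ; rel-pres = assocˡ-mono op }

OpRel-inj₂ : (op : Op) {A B : Set} {R : Rel A 0ℓ} {S : Rel B 0ℓ} {b b' : B} →
             S b b' → OpRel op R S (inj₂ b) (inj₂ b')
OpRel-inj₂ seq r = r
OpRel-inj₂ par r = r

OpRel-inj₁⁻ : (op : Op) {A B : Set} {R : Rel A 0ℓ} {S : Rel B 0ℓ} {a a' : A} →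
              OpRel op R S (inj₁ a) (inj₁ a') → R a a'
OpRel-inj₁⁻ seq r = r
OpRel-inj₁⁻ par r = r

Sum-unitˡ : (op : Op) {B : LStr Γ} → Mor B (Sum op ⟦ botPS ⟧ B)
Sum-unitˡ op = record
  { to = inj₂ ; from = [ (λ ()) , (λ b → b) ]′
  ; from∘to = λ _ → refl ; to∘from = λ { (inj₂ b) → refl }
  ; lbl-pres = λ _ → refl ; rel-pres = λ _ _ → OpRel-inj₂ op }

Sum-unitʳ : (op : Op) {A : LStr Γ} → Mor (Sum op A ⟦ botPS ⟧) A
Sum-unitʳ op = record
  { to = [ (λ a → a) , (λ ()) ]′ ; from = inj₁
  ; from∘to = λ { (inj₁ a) → refl } ; to∘from = λ _ → refl
  ; lbl-pres = λ { (inj₁ a) → refl }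
  ; rel-pres = λ { (inj₁ a) (inj₁ a') → OpRel-inj₁⁻ op } }

-- Algebra of composition up to refinement: each law is obtained by
-- passing to sums, applying the corresponding law there, and passing back.

compose-mono : (op : Op) {x x' y y' : PS Γ} → x ⊑ x' → y ⊑ y' →
               compose op x y ⊑ compose op x' y'
compose-mono op {x} {x'} {y} {y'} p q = Mor⇒⊑ (compose op x y) (compose op x' y')
  (unsplit op x y ∘ᴹ Sum-map op (⊑⇒Mor x x' p) (⊑⇒Mor y y' q) ∘ᴹ split op x' y')

compose-assoc : (op : Op) (x y z : PS Γ) →
                compose op (compose op x y) z ⊑ compose op x (compose op y z)
compose-assoc op x y z = Mor⇒⊑ (compose op (compose op x y) z) (compose op x (compose op y z))
  (unsplit op (compose op x y) z ∘ᴹ Sum-map op (unsplit op x y) Mor-id ∘ᴹ Sum-assoc op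
   ∘ᴹ Sum-map op Mor-id (split op y z) ∘ᴹ split op x (compose op y z))

compose-unitˡ : (op : Op) (y : PS Γ) → compose op botPS y ⊑ y
compose-unitˡ op y = Mor⇒⊑ (compose op botPS y) y (unsplit op botPS y ∘ᴹ Sum-unitˡ op)

compose-unitʳ : (op : Op) (x : PS Γ) → x ⊑ compose op x botPS
compose-unitʳ op x = Mor⇒⊑ x (compose op x botPS) (Sum-unitʳ op ∘ᴹ split op x botPS)

module _ {op : Op} {P : PSet Γ} where
  Star-down : {z w : PS Γ} → z ⊑ w → Star op P w → Star op P z
  Star-down {z} {w} z⊑w (stop (lift w⊑⊥)) =
    stop (lift (⊑-trans {x = z} {w} {botPS} z⊑w w⊑⊥))
  Star-down {z} {w} z⊑w (step x y x∈P y∈P* w⊑) =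
    step x y x∈P y∈P* (⊑-trans {x = z} {w} {compose op x y} z⊑w w⊑)

  -- 𝒫 ⊆ 𝒫^⋈, since x ⊑ x ⋈ ⊥.
  Star-single : {x : PS Γ} → P x → Star op P x
  Star-single {x} x∈P = step x botPS x∈P (stop (lift (⊑-refl botPS))) (compose-unitʳ op x)

  Pow-Star : ∀ k {x w z : PS Γ} → Pow op P k x → Star op P w →
             z ⊑ compose op x w → Star op P z
  Pow-Star zero {x} {w} {z} (lift x⊑⊥) w∈P* z⊑ = Star-down z⊑w w∈P*
    where
    open ⊑-Reasoning
    z⊑w : z ⊑ w
    z⊑w = begin
      z                    ⊑⟨ z⊑ ⟩
      compose op x w       ⊑⟨ compose-mono op x⊑⊥ (⊑-refl w) ⟩
      compose op botPS w   ⊑⟨ compose-unitˡ op w ⟩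
      w                    ∎
  Pow-Star (suc k) {x} {w} {z} (y , p , y∈P , p∈Pᵏ , x⊑) w∈P* z⊑ =
    step y (compose op p w) y∈P (Pow-Star k p∈Pᵏ w∈P* (⊑-refl (compose op p w))) z⊑y⋈[p⋈w]
    where
    open ⊑-Reasoning
    z⊑y⋈[p⋈w] : z ⊑ compose op y (compose op p w)
    z⊑y⋈[p⋈w] = begin
      z                              ⊑⟨ z⊑ ⟩
      compose op x w                 ⊑⟨ compose-mono op x⊑ (⊑-refl w) ⟩
      compose op (compose op y p) w  ⊑⟨ compose-assoc op y p w ⟩
      compose op y (compose op p w)  ∎

  Star-Pow : {z : PS Γ} → Star op P z → ∃ λ k → Pow op P k z
  Star-Pow (stop z⊑⊥) = zero , z⊑⊥
  Star-Pow (step x y x∈P y∈P* z⊑) with Star-Pow y∈P*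
  ... | k , y∈Pᵏ = suc k , x , y , x∈P , y∈Pᵏ , z⊑

  Pow-size : (m : ℕ) → (∀ y → P y → m ≤ size y) →
             ∀ k {z : PS Γ} → Pow op P k z → k * m ≤ size z
  Pow-size m large zero    z∈P⁰ = z≤n
  Pow-size m large (suc k) {z} (y , w , y∈P , w∈Pᵏ , z⊑) = begin
    m + k * m                ≤⟨ +-mono-≤ (large y y∈P) (Pow-size m large k w∈Pᵏ) ⟩
    size y + size w          ≡⟨ size-compose op y w ⟨
    size (compose op y w)    ≤⟨ ⊑-size {x = z} {y = compose op y w} z⊑ ⟩
    size z                   ∎
    where open ≤-Reasoning

Star-mono : {op : Op} {P Q : PSet Γ} →
            (∀ x → P x → ∃ λ k → Pow op Q k x) → Star op P ⊆ₚ Star op Q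
Star-mono P⊆Q* z (stop z⊑⊥) = stop z⊑⊥
Star-mono P⊆Q* z (step x w x∈P w∈P* z⊑) =
  Pow-Star (proj₁ (P⊆Q* x x∈P)) (proj₂ (P⊆Q* x x∈P)) (Star-mono P⊆Q* w w∈P*) z⊑

*≤⇒≤/ : ∀ {k n} m .{{_ : NonZero m}} → k * m ≤ n → k ≤ n / m
*≤⇒≤/ {k} {n} m k*m≤n = subst (_≤ n / m) (m*n/n≡m k m) (/-monoˡ-≤ m k*m≤n)

theorem2 : (Γ : Set) (op : Op) (X Y : PSet Γ) →
    Elementary X → Elementary Y → ¬ Y botPS →
    (ℓX ℓY : ℕ) → IsMaxSize X ℓX → IsMinSize Y ℓY → .{{_ : NonZero ℓY}} →
    (Star op X ⊆ₚ Star op Y) ⇔ (X ⊆ₚ PowUpTo op Y (ℓX / ℓY))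
theorem2 Γ op X Y _ _ _ ℓX ℓY (_ , X-small) (_ , Y-large) = mk⇔ forward backward
  where
  forward : Star op X ⊆ₚ Star op Y → X ⊆ₚ PowUpTo op Y (ℓX / ℓY)
  forward X*⊆Y* x x∈X with Star-Pow (X*⊆Y* x (Star-single x∈X))
  ... | k , x∈Yᵏ =
    k , *≤⇒≤/ ℓY (≤-trans (Pow-size ℓY Y-large k x∈Yᵏ) (X-small x x∈X)) , x∈Yᵏ

  backward : X ⊆ₚ PowUpTo op Y (ℓX / ℓY) → Star op X ⊆ₚ Star op Y
  backward X⊆Yⁿ = Star-mono λ x x∈X → let (k , _ , x∈Yᵏ) = X⊆Yⁿ x x∈X in k , x∈Yᵏ
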